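{- Let $A,B,C$ be any QCL-formulas and let $F_1=((A\vec{\times}B)\vec{\times}C)$ and $F_2=(A\vec{\times}(B\vec{\times}C))$. Then $\mathrm{opt}^G(F_1)=\mathrm{opt}^G(F_2)$ and $\mathrm{deg}^G_\mathcal{I}(F_1)=\mathrm{deg}^G_\mathcal{I}(F_2)$ for all interpretations $\mathcal{I}$.
   Context: QCL-formulas are built from propositional variables (from an infinite set $\mathcal{U}$) using $\neg$, $\wedge$, $\vee$ and the binary connective $\vec{\times}$. An interpretation is a set $\mathcal{I}\subseteq\mathcal{U}$. GCL-optionality: $\mathrm{opt}^G(a)=1$; $\mathrm{opt}^G(\neg F)=\mathrm{opt}^G(F)$; $\mathrm{opt}^G(F\circ G)=\max(\mathrm{opt}^G(F),\mathrm{opt}^G(G))$ for $\circ\in\{\wedge,\vee\}$; $\mathrm{opt}^G(F\vec{\times}G)=\mathrm{opt}^G(F)+\mathrm{opt}^G(G)$. Degrees take values in $\mathbb{Z}\setminus\{0\}$ with the linear order $\trianglelefteq$: on $\mathbb{Z}^+$ and on $\mathbb{Z}^-$ it is the inverse of the natural order, and every negative integer is $\triangleleft$ every positive integer (so $-1\triangleleft-2\triangleleft\cdots\triangleleft\cdots\triangleleft 2\triangleleft 1$). GCL-degree: $\mathrm{deg}^G_\mathcal{I}(a)=1$ if $a\in\mathcal{I}$, $-1$ otherwise; $\mathrm{deg}^G_\mathcal{I}(\neg F)=-\mathrm{deg}^G_\mathcal{I}(F)$; $\mathrm{deg}^G_\mathcal{I}(F\wedge G)=\min(\mathrm{deg}^G_\mathcal{I}(F),\mathrm{deg}^G_\mathcal{I}(G))$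 and $\mathrm{deg}^G_\mathcal{I}(F\vee G)=\max(\mathrm{deg}^G_\mathcal{I}(F),\mathrm{deg}^G_\mathcal{I}(G))$ (min and max w.r.t. $\trianglelefteq$); $\mathrm{deg}^G_\mathcal{I}(F\vec{\times}G)=\mathrm{deg}^G_\mathcal{I}(F)$ if $\mathrm{deg}^G_\mathcal{I}(F)\in\mathbb{Z}^+$; $=\mathrm{opt}^G(F)+\mathrm{deg}^G_\mathcal{I}(G)$ if $\mathrm{deg}^G_\mathcal{I}(F)\in\mathbb{Z}^-$ and $\mathrm{deg}^G_\mathcal{I}(G)\in\mathbb{Z}^+$; and $=\mathrm{deg}^G_\mathcal{I}(F)-\mathrm{opt}^G(G)$ otherwise. -}

module Defs where

open import Data.Nat as ℕ using (ℕ)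
open import Data.Integer using (ℤ; +_; -[1+_]; _+_; _-_; -_)
open import Data.Bool using (Bool; true; false; if_then_else_)

-- Propositional variables: the infinite set 𝓤 is taken to be ℕ.
Var : Set
Var = ℕ

data Formula : Set where
  var  : Var → Formula
  ¬′_  : Formula → Formula
  _∧′_ : Formula → Formula → Formula
  _∨′_ : Formula → Formula → Formula
  _×⃗_ : Formula → Formula → Formula

-- An interpretation I ⊆ 𝓤, given by its characteristic function.
Interpretation : Set
Interpretation = Var → Bool

optG : Formula → ℕ
optG (var a)   = 1
optG (¬′ F)    = optG F
optG (F ∧′ G)  = optG F ℕ.⊔ optG G
optG (F ∨′ G)  = optG F ℕ.⊔ optG G
optG (F ×⃗ G)  = optG F ℕ.+ optG G

-- Degrees live in ℤ ∖ {0}; we compute in ℤ (all computed values are nonzero).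
-- The order ⊴: -1 ◁ -2 ◁ ... ◁ ... ◁ 2 ◁ 1.
-- x ⊴ y as a boolean test.
_⊴ᵇ_ : ℤ → ℤ → Bool
-[1+ m ] ⊴ᵇ -[1+ n ] = m ℕ.≤ᵇ n
-[1+ m ] ⊴ᵇ (+ n)    = true
(+ m)    ⊴ᵇ -[1+ n ] = false
(+ m)    ⊴ᵇ (+ n)    = n ℕ.≤ᵇ m

min⊴ : ℤ → ℤ → ℤ
min⊴ x y = if x ⊴ᵇ y then x else y

max⊴ : ℤ → ℤ → ℤ
max⊴ x y = if x ⊴ᵇ y then y else x

isPos : ℤ → Bool
isPos (+ ℕ.zero)  = false
isPos (+ ℕ.suc _) = true
isPos -[1+ _ ]    = false

degG : Interpretation → Formula → ℤ
degG I (var a)  = if I a then + 1 else - (+ 1)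
degG I (¬′ F)   = - degG I F
degG I (F ∧′ G) = min⊴ (degG I F) (degG I G)
degG I (F ∨′ G) = max⊴ (degG I F) (degG I G)
degG I (F ×⃗ G) with isPos (degG I F) | isPos (degG I G)
... | true  | _     = degG I F
... | false | true  = + optG F + degG I G
... | false | false = degG I F - + optG G

{-# OPTIONS --safe #-}
module Submission where

open import Defs
open import Data.Product using (_×_; _,_)
open import Relation.Binary.PropositionalEquality using (_≡_; refl; cong; module ≡-Reasoning)
open import Data.Nat as ℕ using (ℕ)
import Data.Nat.Properties as ℕ
open import Data.Integer using (ℤ; +_; -[1+_]; _+_; _-_; -_)
import Data.Integer.Properties as ℤ
open import Data.Bool using (Bool; true; false)

-- The degree of F ×⃗ G depends on F and G only through their degrees and
-- optionalities, so associativity is an identity about this operation on ℤ × ℕ.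
-- It holds because ×⃗ keeps a positive degree and keeps a non-positive one
-- non-positive, so both bracketings take the same branch.

seqDegBy : Bool → Bool → ℤ → ℕ → ℤ → ℕ → ℤ
seqDegBy true  _     a oa b ob = a
seqDegBy false true  a oa b ob = + oa + b
seqDegBy false false a oa b ob = a - + ob

seqDeg : ℤ → ℕ → ℤ → ℕ → ℤ
seqDeg a oa b ob = seqDegBy (isPos a) (isPos b) a oa b ob

degG-×⃗ : ∀ I F G → degG I (F ×⃗ G) ≡ seqDeg (degG I F) (optG F) (degG I G) (optG G)
degG-×⃗ I F G with isPos (degG I F) | isPos (degG I G)
... | true  | _     = refl
... | false | true  = refl
... | false | false = refl

isPos-+ : ∀ n b → isPos b ≡ true → isPos (+ n + b) ≡ true
isPos-+ n (+ ℕ.suc m) _ rewrite ℕ.+-suc n m = refl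

isPos-- : ∀ a n → isPos a ≡ false → isPos (a - + n) ≡ false
isPos-- (+ ℕ.zero) ℕ.zero     _ = refl
isPos-- (+ ℕ.zero) (ℕ.suc n)  _ = refl
isPos-- -[1+ m ]   ℕ.zero     _ = refl
isPos-- -[1+ m ]   (ℕ.suc n)  _ = refl

seqDeg-assoc : ∀ a oa b ob c oc →
  seqDeg (seqDeg a oa b ob) (oa ℕ.+ ob) c oc ≡ seqDeg a oa (seqDeg b ob c oc) (ob ℕ.+ oc)
seqDeg-assoc a oa b ob c oc with isPos a in sign-a | isPos b in sign-b | isPos c in sign-c
... | true  | _     | _     rewrite sign-a = refl
... | false | true  | _     rewrite isPos-+ oa b sign-b | sign-b = refl
... | false | false | true  rewrite isPos-- a ob sign-a | isPos-+ ob c sign-c =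
  ℤ.+-assoc (+ oa) (+ ob) c
... | false | false | false rewrite isPos-- a ob sign-a | isPos-- b oc sign-b = begin
  a - + ob - + oc        ≡⟨ ℤ.+-assoc a (- + ob) (- + oc) ⟩
  a + (- + ob - + oc)    ≡⟨ cong (λ x → a + x) (ℤ.neg-distrib-+ (+ ob) (+ oc)) ⟨
  a - (+ ob + + oc)      ∎
  where open ≡-Reasoning

lemma5 : (A B C : Formula) →
    (optG ((A ×⃗ B) ×⃗ C) ≡ optG (A ×⃗ (B ×⃗ C)))
    × ((I : Interpretation) → degG I ((A ×⃗ B) ×⃗ C) ≡ degG I (A ×⃗ (B ×⃗ C)))
lemma5 A B C = ℕ.+-assoc (optG A) (optG B) (optG C) , λ I → begin
  degG I ((A ×⃗ B) ×⃗ C)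
    ≡⟨ degG-×⃗ I (A ×⃗ B) C ⟩
  seqDeg (degG I (A ×⃗ B)) (optG A ℕ.+ optG B) (degG I C) (optG C)
    ≡⟨ cong (λ x → seqDeg x (optG A ℕ.+ optG B) (degG I C) (optG C)) (degG-×⃗ I A B) ⟩
  seqDeg (seqDeg (degG I A) (optG A) (degG I B) (optG B)) (optG A ℕ.+ optG B) (degG I C) (optG C)
    ≡⟨ seqDeg-assoc (degG I A) (optG A) (degG I B) (optG B) (degG I C) (optG C) ⟩
  seqDeg (degG I A) (optG A) (seqDeg (degG I B) (optG B) (degG I C) (optG C)) (optG B ℕ.+ optG C)
    ≡⟨ cong (λ x → seqDeg (degG I A) (optG A) x (optG B ℕ.+ optG C)) (degG-×⃗ I B C) ⟨
  seqDeg (degG I A) (optG A) (degG I (B ×⃗ C)) (optG B ℕ.+ optG C)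
    ≡⟨ degG-×⃗ I A (B ×⃗ C) ⟨
  degG I (A ×⃗ (B ×⃗ C))
    ∎
  where open ≡-Reasoning
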